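{- For every $n\ge 2$ there exists a data vector $d\in\mathbb{R}^{\binom{n}{2}}$ lying in the interior of at least $(n-1)!$ distinct projection cones $P_{\mathcal{F}}$; equivalently, some maximal cell of the common refinement $\mathcal{Q}_n$ of all projection cones is the intersection of at least $(n-1)!$ projection cones, so that $d$ orthogonally projects onto at least $(n-1)!$ non-degenerate equidistant trees.
   Context: Coordinates of $\mathbb{R}^{\binom{n}{2}}$ are indexed by unordered pairs $\{i,j\}$ of distinct elements of $[n]=\{1,\dots,n\}$, with the standard inner product. A maximal chain of partitions $\mathcal{F}$ is a sequence $\pi_0,\dots,\pi_{n-1}$ of set partitions of $[n]$, where $\pi_0$ consists of singletons and $\pi_k$ is obtained from $\pi_{k-1}$ by merging two blocks $S_k,T_k$ into $S_k\cup T_k$; distinct chains are distinct sequences of partitions. Set $D_k=\{\{i,j\}: i\in S_k,\ j\in T_k\}$. Define $C_{\mathcal{F}}=\{x: x \text{ constant on each } D_k \text{ with value } c_k,\ c_1\le\cdots\le c_{n-1}\}$ (the cone of equidistant tree vectors of the corresponding tree shape) and $L_{\mathcal{F}}=\{x: x \text{ constant on each } D_k\}$. The projection cone is $P_{\mathcal{F}}=C_{\mathcal{F}}+L_{\mathcal{F}}^{\perp}$, the set of points whose orthogonal projection onto $L_{\mathcal{F}}$ lies in $C_{\mathcal{F}}$; it equals the cone defined by $\frac{1}{|D_k|}\sum_{D_k}x\le \frac{1}{|D_{k+1}|}\sum_{D_{k+1}}x$ for $k=1,\dots,n-2$. $\mathcal{Q}_n$ denotes the common refinement of all the cones $P_{\mathcal{F}}$,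 a complete polyhedral fan in $\mathbb{R}^{\binom{n}{2}}$.
   Formalization: The data vector d has rational coordinates, and the interiors of the projection cones $P_{\mathcal{F}}$ are taken in ℚ^(n choose 2) rather than in $\mathbb{R}^{\binom{n}{2}}$. -}

module Defs where

open import Data.Nat using (ℕ; zero; suc; _∸_; _<_; _<?_)
open import Data.Fin using (Fin; _≟_)
import Data.Fin as F
open import Data.Bool using (T?; Bool; true; false; _∧_; _∨_; not; if_then_else_)
open import Data.Product using (Σ; _×_; _,_; ∃; proj₁; proj₂)
open import Data.List using (allFin; List; []; _∷_; filter; length; map; sum; concatMap; foldr)
open import Data.Integer using (+_)
open import Data.Rational using (ℚ; 0ℚ; _+_; _*_; _-_; ∣_∣; _/_)
import Data.Rational as Q
open import Relation.Nullary using (does; yes; no)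
open import Relation.Binary.PropositionalEquality using (_≡_; _≢_)

-- Coordinates of ℝ^(n choose 2): unordered pairs {i,j}, i ≠ j,
-- represented as ordered pairs (i , j) with i < j.
Pair : ℕ → Set
Pair n = Σ (Fin n × Fin n) (λ p → proj₁ p F.< proj₂ p)

Point : ℕ → Set
Point n = Pair n → ℚ

allPairs : (n : ℕ) → List (Pair n)
allPairs n = concatMap (λ i → concatMap (λ j → pick i j) (allFin n)) (allFin n)
  where
  pick : Fin n → Fin n → List (Pair n)
  pick i j with F.toℕ i <? F.toℕ j
  ... | yes p = ((i , j) , p) ∷ []
  ... | no _ = []

-- A set partition of [n], given as its (boolean) equivalence relation
-- "i and j lie in the same block".
Partition : ℕ → Set
Partition n = Fin n → Fin n → Bool

-- A sequence of partitions π₀, π₁, … (only indices 0 … n-1 matter).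
PartSeq : ℕ → Set
PartSeq n = ℕ → Partition n

-- π' is obtained from π by merging the (distinct) blocks of a and b.
MergeOf : {n : ℕ} → Partition n → Partition n → Set
MergeOf {n} π π' =
  Σ (Fin n) λ a → Σ (Fin n) λ b →
    (π a b ≡ false) ×
    (∀ x y → π' x y ≡ (π x y ∨ ((π x a ∧ π y b) ∨ (π x b ∧ π y a))))

IsMaximalChain : (n : ℕ) → PartSeq n → Set
IsMaximalChain n π =
  (∀ x y → π 0 x y ≡ does (x ≟ y)) ×
  (∀ k → suc k < n → MergeOf (π k) (π (suc k)))

MaximalChain : ℕ → Set
MaximalChain n = Σ (PartSeq n) (IsMaximalChain n)

DistinctChains : {n : ℕ} → MaximalChain n → MaximalChain n → Set
DistinctChains {n} F G =
  Σ ℕ λ k → (k < n) × Σ (Fin n) λ x → Σ (Fin n) λ y → proj₁ F k x y ≢ proj₁ G k x y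

inD : {n : ℕ} → MaximalChain n → ℕ → Pair n → Bool
inD F zero _ = false
inD F (suc k) ((i , j) , _) = proj₁ F (suc k) i j ∧ not (proj₁ F k i j)

Dlist : {n : ℕ} → MaximalChain n → ℕ → List (Pair n)
Dlist {n} F k = filter (λ p → T? (inD F k p)) (allPairs n)

sumℚ : List ℚ → ℚ
sumℚ = foldr _+_ 0ℚ

-- (1/|D_k|) Σ_{D_k} x   (D_k is never empty for k = 1 … n-1).
avgD : {n : ℕ} → MaximalChain n → ℕ → Point n → ℚ
avgD F k x with length (Dlist F k)
... | zero = 0ℚ
... | suc m = sumℚ (map x (Dlist F k)) * ((+ 1) / suc m)

inP : {n : ℕ} → MaximalChain n → Point n → Set
inP {n} F x = ∀ k → suc (suc k) < n → avgD F (suc k) x Q.≤ avgD F (suc (suc k)) x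

InInterior : {n : ℕ} → (Point n → Set) → Point n → Set
InInterior {n} C d =
  Σ ℚ λ ε → (0ℚ Q.< ε) × (∀ (y : Point n) → (∀ p → ∣ y p - d p ∣ Q.< ε) → C y)

module Submission where

-- Fix the leaf 0. Each ordering of the other n - 1 leaves gives a caterpillar chain, in which the
-- block of 0 absorbs the remaining leaves one at a time; distinct orderings give distinct chains.
-- In such a chain D_(k+1) consists of the k + 1 pairs joining the new leaf to the current block.
-- For the data vector d with d_ij = 0 if 0 ∈ {i, j} and d_ij = 1 otherwise, the mean of d over
-- D_(k+1) is therefore k / (k + 1), for every caterpillar. These means increase with gaps of at
-- least 1/n², while perturbing d by less than ε in every coordinate moves each mean by at most ε.
-- So the sup-norm ball of radius 1/(2n² + 1) around d lies in all (n - 1)! projection cones.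

open import Defs
open import Data.Bool using (Bool; true; false; _∧_; _∨_; not; T?)
import Data.Bool.Properties as Boolₚ
open import Data.Bool.Solver using (module ∨-∧-Solver)
open import Data.Empty using (⊥-elim)
open import Data.Fin as Fin using (Fin; zero; suc; toℕ; _≟_)
import Data.Fin.Properties as Finₚ
open Finₚ using (_<?_)
open import Data.Fin.Permutation
  using (Permutation′; _⟨$⟩ʳ_; _⟨$⟩ˡ_; lift₀; transpose; _∘ₚ_; _≈_; inverseˡ; inverseʳ)
import Data.Fin.Permutation as Perm
import Data.Fin.Permutation.Components as PC
open import Data.Integer as ℤ using (+_)
import Data.Integer.Properties as ℤₚ
open import Data.List using (List; []; _∷_; _++_; map; filter; length; concatMap; allFin; tabulate)
import Data.List.Properties as Listₚ
open import Data.Nat as ℕ using (ℕ; zero; suc; _+_; _*_; _≤_; _<_; _∸_; _!; z≤n; s≤s)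
import Data.Nat.Properties as ℕₚ
open import Algebra.Properties.Semiring.Sum ℕₚ.+-*-semiring
  using (sum-syntax; ∑-distrib-+; *-distribˡ-sum; sum-cong-≗; sum-replicate-zero; ∑-permute)
  renaming (sum to ∑)
open import Data.Nat.ListAction using (sum)
open import Data.Nat.ListAction.Properties using (sum-++)
open import Data.Nat.Tactic.RingSolver using (solve-∀)
open import Data.Product using (Σ; ∃; _×_; _,_; proj₁; proj₂)
open import Data.Rational as ℚ using (ℚ; 0ℚ; 1ℚ; _/_; toℚᵘ; ∣_∣)
import Data.Rational.Properties as ℚₚ
open import Data.Rational.Solver using (module +-*-Solver)
open import Data.Rational.Unnormalised as ℚᵘ using (mkℚᵘ; *≡*; *≤*)
import Data.Rational.Unnormalised.Properties as ℚᵘₚ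
open import Data.Sum as Sum using (_⊎_; [_,_]′)
open import Function using (_∘_)
open import Function.Bundles using (mk⇔)
open import Relation.Binary using (tri<; tri≈; tri>)
open import Relation.Binary.PropositionalEquality
open import Relation.Nullary using (does; yes; no)
open import Relation.Nullary.Decidable using (dec-true; dec-false; does-⇔; _⊎-dec_)

𝟙 : Bool → ℕ
𝟙 true = 1
𝟙 false = 0

δ : ∀ {n} → Fin n → Fin n → ℕ
δ x y = 𝟙 (does (x ≟ y))

𝟙< : ∀ {n} → Fin n → Fin n → ℕ
𝟙< x y = 𝟙 (does (x <? y))

∑-δ : ∀ {n} (b : Fin n) (f : Fin n → ℕ) → ∑[ i < n ] (δ i b * f i) ≡ f b
∑-δ {suc n} zero f = begin
  f zero + 0 + ∑[ i < n ] 0 ≡⟨ cong₂ _+_ (ℕₚ.+-identityʳ (f zero)) (sum-replicate-zero n) ⟩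
  f zero + 0               ≡⟨ ℕₚ.+-identityʳ (f zero) ⟩
  f zero                   ∎
  where open ≡-Reasoning
∑-δ {suc n} (suc b) f = ∑-δ b (f ∘ suc)

δ-subst : ∀ {n} (x b : Fin n) (f : Fin n → ℕ) → δ x b * f x ≡ δ x b * f b
δ-subst x b f with x ≟ b
... | yes refl = refl
... | no _     = refl

𝟙-trichotomy : ∀ {n} (b x : Fin n) → δ x b + 𝟙< b x + 𝟙< x b ≡ 1
𝟙-trichotomy b x with Finₚ.<-cmp x b
... | tri< x<b x≢b _
  rewrite dec-false (x ≟ b) x≢b | dec-false (b <? x) (ℕₚ.<-asym x<b) | dec-true (x <? b) x<b = refl
... | tri≈ x≮b x≡b b≮x
  rewrite dec-true (x ≟ b) x≡b | dec-false (b <? x) b≮x | dec-false (x <? b) x≮b = refl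
... | tri> _ x≢b b<x
  rewrite dec-false (x ≟ b) x≢b | dec-true (b <? x) b<x | dec-false (x <? b) (ℕₚ.<-asym b<x) = refl

∑-split-at : ∀ {n} (b : Fin n) (h : Fin n → ℕ) →
  ∑[ x < n ] h x ≡ h b + ∑[ x < n ] (𝟙< b x * h x) + ∑[ x < n ] (𝟙< x b * h x)
∑-split-at {n} b h = begin
  ∑[ x < n ] h x
    ≡⟨ sum-cong-≗ (λ x → trans (sym (ℕₚ.*-identityˡ (h x))) (cong (_* h x) (sym (𝟙-trichotomy b x)))) ⟩
  ∑[ x < n ] ((δ x b + 𝟙< b x + 𝟙< x b) * h x)
    ≡⟨ sum-cong-≗ (λ x → distrib (δ x b) (𝟙< b x) (𝟙< x b) (h x)) ⟩
  ∑[ x < n ] (δ x b * h x + 𝟙< b x * h x + 𝟙< x b * h x)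
    ≡⟨ ∑-distrib-+ (λ x → δ x b * h x + 𝟙< b x * h x) (λ x → 𝟙< x b * h x) ⟩
  ∑[ x < n ] (δ x b * h x + 𝟙< b x * h x) + ∑[ x < n ] (𝟙< x b * h x)
    ≡⟨ cong (_+ ∑[ x < n ] (𝟙< x b * h x)) (∑-distrib-+ (λ x → δ x b * h x) (λ x → 𝟙< b x * h x)) ⟩
  ∑[ x < n ] (δ x b * h x) + ∑[ x < n ] (𝟙< b x * h x) + ∑[ x < n ] (𝟙< x b * h x)
    ≡⟨ cong (λ c → c + ∑[ x < n ] (𝟙< b x * h x) + ∑[ x < n ] (𝟙< x b * h x)) (∑-δ b h) ⟩
  h b + ∑[ x < n ] (𝟙< b x * h x) + ∑[ x < n ] (𝟙< x b * h x) ∎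
  where
  open ≡-Reasoning
  distrib : ∀ a b c d → (a + b + c) * d ≡ a * d + b * d + c * d
  distrib = solve-∀

∑-pairs-through : ∀ {n} (b : Fin n) (h : Fin n → ℕ) → h b ≡ 0 →
  ∑[ i < n ] ∑[ j < n ] (𝟙< i j * (δ i b * h j + δ j b * h i)) ≡ ∑[ x < n ] h x
∑-pairs-through {n} b h hb≡0 = begin
  ∑[ i < n ] ∑[ j < n ] (𝟙< i j * (δ i b * h j + δ j b * h i))
    ≡⟨ sum-cong-≗ (λ i → trans (sum-cong-≗ (λ j → distrib (𝟙< i j) (δ i b) (h j) (δ j b) (h i)))
                               (∑-distrib-+ (λ j → δ i b * (𝟙< i j * h j)) (λ j → δ j b * (𝟙< i j * h i)))) ⟩
  ∑[ i < n ] (∑[ j < n ] (δ i b * (𝟙< i j * h j)) + ∑[ j < n ] (δ j b * (𝟙< i j * h i)))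
    ≡⟨ sum-cong-≗ (λ i → cong₂ _+_ (sym (*-distribˡ-sum (δ i b) (λ j → 𝟙< i j * h j)))
                                   (∑-δ b (λ j → 𝟙< i j * h i))) ⟩
  ∑[ i < n ] (δ i b * ∑[ j < n ] (𝟙< i j * h j) + 𝟙< i b * h i)
    ≡⟨ ∑-distrib-+ (λ i → δ i b * ∑[ j < n ] (𝟙< i j * h j)) (λ i → 𝟙< i b * h i) ⟩
  ∑[ i < n ] (δ i b * ∑[ j < n ] (𝟙< i j * h j)) + ∑[ i < n ] (𝟙< i b * h i)
    ≡⟨ cong (_+ ∑[ i < n ] (𝟙< i b * h i)) (∑-δ b (λ i → ∑[ j < n ] (𝟙< i j * h j))) ⟩
  0 + ∑[ j < n ] (𝟙< b j * h j) + ∑[ i < n ] (𝟙< i b * h i)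
    ≡⟨ cong (λ c → c + ∑[ j < n ] (𝟙< b j * h j) + ∑[ i < n ] (𝟙< i b * h i)) hb≡0 ⟨
  h b + ∑[ j < n ] (𝟙< b j * h j) + ∑[ i < n ] (𝟙< i b * h i)
    ≡⟨ ∑-split-at b h ⟨
  ∑[ x < n ] h x ∎
  where
  open ≡-Reasoning
  distrib : ∀ l e hj e′ hi → l * (e * hj + e′ * hi) ≡ e * (l * hj) + e′ * (l * hi)
  distrib = solve-∀

count-≤ : ∀ {n k} → k < n → ∑[ y < n ] 𝟙 (does (toℕ y ℕ.≤? k)) ≡ suc k
count-≤ {suc n} {zero}  _          = cong suc (sum-replicate-zero n)
count-≤ {suc n} {suc k} (s≤s k<n) = cong suc (trans (sum-cong-≗ {n} shift) (count-≤ k<n))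
  where
  shift : ∀ y → 𝟙 (does (suc (toℕ y) ℕ.≤? suc k)) ≡ 𝟙 (does (toℕ y ℕ.≤? k))
  shift y = cong 𝟙 (does-⇔ (mk⇔ ℕ.s≤s⁻¹ s≤s) (suc (toℕ y) ℕ.≤? suc k) (toℕ y ℕ.≤? k))

sum-tabulate : ∀ {n} (f : Fin n → ℕ) → sum (tabulate f) ≡ ∑[ i < n ] f i
sum-tabulate {zero} f = refl
sum-tabulate {suc n} f = cong (_+_ (f zero)) (sum-tabulate (f ∘ suc))

sum-allFin : ∀ {n} (f : Fin n → ℕ) → sum (map f (allFin n)) ≡ ∑[ i < n ] f i
sum-allFin f = trans (cong sum (Listₚ.map-tabulate (λ i → i) f)) (sum-tabulate f)

sum-concatMap : ∀ {A B : Set} (g : B → ℕ) (f : A → List B) (xs : List A) →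
  sum (map g (concatMap f xs)) ≡ sum (map (λ x → sum (map g (f x))) xs)
sum-concatMap g f [] = refl
sum-concatMap g f (x ∷ xs) = begin
  sum (map g (f x ++ concatMap f xs))
    ≡⟨ cong sum (Listₚ.map-++ g (f x) (concatMap f xs)) ⟩
  sum (map g (f x) ++ map g (concatMap f xs))
    ≡⟨ sum-++ (map g (f x)) (map g (concatMap f xs)) ⟩
  sum (map g (f x)) + sum (map g (concatMap f xs))
    ≡⟨ cong (_+_ (sum (map g (f x)))) (sum-concatMap g f xs) ⟩
  sum (map g (f x)) + sum (map (λ x → sum (map g (f x))) xs) ∎
  where open ≡-Reasoning

sum-filter : ∀ {A : Set} (P : A → Bool) (f : A → ℕ) (xs : List A) →
  sum (map f (filter (λ x → T? (P x)) xs)) ≡ sum (map (λ x → 𝟙 (P x) * f x) xs)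
sum-filter P f [] = refl
sum-filter P f (x ∷ xs) with P x
... | true  = cong₂ _+_ (sym (ℕₚ.+-identityʳ (f x))) (sum-filter P f xs)
... | false = sum-filter P f xs

length≡sum-of-ones : ∀ {A : Set} (xs : List A) → length xs ≡ sum (map (λ _ → 1) xs)
length≡sum-of-ones [] = refl
length≡sum-of-ones (_ ∷ xs) = cong suc (length≡sum-of-ones xs)

uncurryPair : ∀ {n} {A : Set} → (Fin n → Fin n → A) → Pair n → A
uncurryPair g ((i , j) , _) = g i j

-- Names the local function of allPairs: its (i , j) block is [ (i , j) ] if i < j and [] otherwise.
allPairs-blocks : (n : ℕ) → Σ (Fin n → Fin n → List (Pair n)) λ block →
  allPairs n ≡ concatMap (λ i → concatMap (block i) (allFin n)) (allFin n)
allPairs-blocks n = _ , refl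

sum-block : ∀ {n} (g : Fin n → Fin n → ℕ) (i j : Fin n) →
  sum (map (uncurryPair g) (proj₁ (allPairs-blocks n) i j)) ≡ 𝟙< i j * g i j
sum-block g i j with toℕ i ℕ.<? toℕ j
... | yes i<j rewrite dec-true (i <? j) i<j = refl
... | no i≮j rewrite dec-false (i <? j) i≮j = refl

sum-allPairs : ∀ {n} (g : Fin n → Fin n → ℕ) →
  sum (map (uncurryPair g) (allPairs n)) ≡ ∑[ i < n ] ∑[ j < n ] (𝟙< i j * g i j)
sum-allPairs {n} g = begin
  sum (map (uncurryPair g) (concatMap (λ i → concatMap (block i) (allFin n)) (allFin n)))
    ≡⟨ sum-concatMap (uncurryPair g) (λ i → concatMap (block i) (allFin n)) (allFin n) ⟩
  sum (map (λ i → sum (map (uncurryPair g) (concatMap (block i) (allFin n)))) (allFin n))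
    ≡⟨ sum-allFin (λ i → sum (map (uncurryPair g) (concatMap (block i) (allFin n)))) ⟩
  ∑[ i < n ] sum (map (uncurryPair g) (concatMap (block i) (allFin n)))
    ≡⟨ sum-cong-≗ (λ i → trans (sum-concatMap (uncurryPair g) (block i) (allFin n))
                                    (sum-allFin (λ j → sum (map (uncurryPair g) (block i j))))) ⟩
  ∑[ i < n ] ∑[ j < n ] sum (map (uncurryPair g) (block i j))
    ≡⟨ sum-cong-≗ (λ i → sum-cong-≗ (sum-block g i)) ⟩
  ∑[ i < n ] ∑[ j < n ] (𝟙< i j * g i j) ∎
  where
  open ≡-Reasoning
  block = proj₁ (allPairs-blocks n)

𝟙-new-pair : ∀ ji jj bi bj → bi ∧ ji ≡ false → bj ∧ jj ≡ false → bi ∧ bj ≡ false →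
  𝟙 (((ji ∨ bi) ∧ (jj ∨ bj)) ∧ not (ji ∧ jj)) ≡ 𝟙 bi * 𝟙 jj + 𝟙 bj * 𝟙 ji
𝟙-new-pair _     _     true  true  _  _  ()
𝟙-new-pair true  _     true  _     () _  _
𝟙-new-pair _     true  _     true  _  () _
𝟙-new-pair false true  true  false _  _  _ = refl
𝟙-new-pair false false true  false _  _  _ = refl
𝟙-new-pair true  false false true  _  _  _ = refl
𝟙-new-pair false false false true  _  _  _ = refl
𝟙-new-pair true  true  false false _  _  _ = refl
𝟙-new-pair true  false false false _  _  _ = refl
𝟙-new-pair false true  false false _  _  _ = refl
𝟙-new-pair false false false false _  _  _ = refl

distinct-∧ : ∀ {n} {x y : Fin n} b → x ≢ y → does (x ≟ b) ∧ does (y ≟ b) ≡ false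
distinct-∧ {x = x} {y} b x≢y with x ≟ b | y ≟ b
... | yes refl | yes refl = ⊥-elim (x≢y refl)
... | yes _    | no _     = refl
... | no _     | _        = refl

∧-∨-expand : ∀ jx jy bx by → bx ∧ by ≡ false →
  (jx ∨ bx) ∧ (jy ∨ by) ≡ (jx ∧ jy) ∨ ((jx ∧ by) ∨ (bx ∧ jy))
∧-∨-expand jx jy bx by bx∧by≡false = begin
  (jx ∨ bx) ∧ (jy ∨ by)    ≡⟨ expand jx jy bx by ⟩
  rest ∨ (bx ∧ by)          ≡⟨ cong (rest ∨_) bx∧by≡false ⟩
  rest ∨ false              ≡⟨ Boolₚ.∨-identityʳ rest ⟩
  rest                      ∎
  where
  open ≡-Reasoning
  open ∨-∧-Solver
  rest = (jx ∧ jy) ∨ ((jx ∧ by) ∨ (bx ∧ jy))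
  expand : ∀ jx jy bx by → (jx ∨ bx) ∧ (jy ∨ by) ≡ ((jx ∧ jy) ∨ ((jx ∧ by) ∨ (bx ∧ jy))) ∨ (bx ∧ by)
  expand = solve 4 (λ jx jy bx by →
    (jx :+ bx) :* (jy :+ by) := ((jx :* jy) :+ ((jx :* by) :+ (bx :* jy))) :+ (bx :* by)) refl

extend : ∀ {p} → Fin (suc p) → Permutation′ p → Permutation′ (suc p)
extend c σ = lift₀ σ ∘ₚ transpose zero c

extend-injective : ∀ {p} {c c′ : Fin (suc p)} {σ σ′ : Permutation′ p} →
  extend c σ ≈ extend c′ σ′ → c ≡ c′ × σ ≈ σ′
extend-injective {c = c} {σ = σ} {σ′} eq with eq zero
... | refl = refl , λ x → Finₚ.suc-injective (begin
  suc (σ ⟨$⟩ʳ x)                                   ≡⟨ PC.transpose-inverse c zero ⟨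
  PC.transpose c zero (extend c σ ⟨$⟩ʳ suc x)      ≡⟨ cong (PC.transpose c zero) (eq (suc x)) ⟩
  PC.transpose c zero (extend c σ′ ⟨$⟩ʳ suc x)     ≡⟨ PC.transpose-inverse c zero ⟩
  suc (σ′ ⟨$⟩ʳ x)                                  ∎)
  where open ≡-Reasoning

permutationAt : ∀ p → Fin (p !) → Permutation′ p
permutationAt zero    _ = Perm.id
permutationAt (suc p) a = extend (proj₁ (Fin.remQuot {suc p} (p !) a))
                                (permutationAt p (proj₂ (Fin.remQuot {suc p} (p !) a)))

permutationAt-injective : ∀ p {a b} → permutationAt p a ≈ permutationAt p b → a ≡ b
permutationAt-injective zero {zero} {zero} _ = refl
permutationAt-injective (suc p) {a} {b} eq with extend-injective eq
... | c≡c′ , σ≈σ′ = begin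
  a                                    ≡⟨ Finₚ.combine-remQuot {suc p} (p !) a ⟨
  Fin.combine (proj₁ qa) (proj₂ qa)    ≡⟨ cong₂ Fin.combine c≡c′ (permutationAt-injective p σ≈σ′) ⟩
  Fin.combine (proj₁ qb) (proj₂ qb)    ≡⟨ Finₚ.combine-remQuot {suc p} (p !) b ⟩
  b                                    ∎
  where
  open ≡-Reasoning
  qa = Fin.remQuot {suc p} (p !) a
  qb = Fin.remQuot {suc p} (p !) b

permutationAt-distinct : ∀ p {a b} → a ≢ b → ∃ λ x → permutationAt p a ⟨$⟩ʳ x ≢ permutationAt p b ⟨$⟩ʳ x
permutationAt-distinct p {a} {b} a≢b =
  Finₚ.¬∀⟶∃¬ p _ (λ x → permutationAt p a ⟨$⟩ʳ x ≟ permutationAt p b ⟨$⟩ʳ x) (a≢b ∘ permutationAt-injective p)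

toℚᵘ-/suc : ∀ a b → toℚᵘ (+ a / suc b) ℚᵘ.≃ mkℚᵘ (+ a) b
toℚᵘ-/suc a b = ℚₚ.toℚᵘ-fromℚᵘ (mkℚᵘ (+ a) b)

/suc-≡ : ∀ a b c d → a * suc d ≡ c * suc b → + a / suc b ≡ + c / suc d
/suc-≡ a b c d eq = ℚₚ.toℚᵘ-injective (ℚᵘₚ.≃-trans (toℚᵘ-/suc a b)
  (ℚᵘₚ.≃-trans (*≡* (subst₂ _≡_ (ℤₚ.pos-* a (suc d)) (ℤₚ.pos-* c (suc b)) (cong +_ eq)))
               (ℚᵘₚ.≃-sym (toℚᵘ-/suc c d))))

/suc-≤ : ∀ a b c d → a * suc d ≤ c * suc b → + a / suc b ℚ.≤ + c / suc d
/suc-≤ a b c d le = ℚₚ.toℚᵘ-cancel-≤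
  (ℚᵘₚ.≤-respˡ-≃ (ℚᵘₚ.≃-sym (toℚᵘ-/suc a b)) (ℚᵘₚ.≤-respʳ-≃ (ℚᵘₚ.≃-sym (toℚᵘ-/suc c d))
    (*≤* (subst₂ ℤ._≤_ (ℤₚ.pos-* a (suc d)) (ℤₚ.pos-* c (suc b)) (ℤ.+≤+ le)))))

/suc-+ : ∀ a b c d → + a / suc b ℚ.+ + c / suc d ≡ + (a * suc d + c * suc b) / (suc b * suc d)
/suc-+ a b c d = ℚₚ.toℚᵘ-injective (ℚᵘₚ.≃-trans (ℚₚ.toℚᵘ-homo-+ (+ a / suc b) (+ c / suc d))
  (ℚᵘₚ.≃-trans (ℚᵘₚ.+-cong (toℚᵘ-/suc a b) (toℚᵘ-/suc c d))
    (ℚᵘₚ.≃-trans (ℚᵘₚ.≃-reflexive (cong (λ z → mkℚᵘ z (d + b * suc d)) numerator))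
      (ℚᵘₚ.≃-sym (toℚᵘ-/suc (a * suc d + c * suc b) (d + b * suc d))))))
  where
  numerator : + a ℤ.* + suc d ℤ.+ + c ℤ.* + suc b ≡ + (a * suc d + c * suc b)
  numerator = sym (trans (ℤₚ.pos-+ (a * suc d) (c * suc b))
                         (cong₂ ℤ._+_ (ℤₚ.pos-* a (suc d)) (ℤₚ.pos-* c (suc b))))

/suc-* : ∀ a b c d → + a / suc b ℚ.* (+ c / suc d) ≡ + (a * c) / (suc b * suc d)
/suc-* a b c d = ℚₚ.toℚᵘ-injective (ℚᵘₚ.≃-trans (ℚₚ.toℚᵘ-homo-* (+ a / suc b) (+ c / suc d))
  (ℚᵘₚ.≃-trans (ℚᵘₚ.*-cong (toℚᵘ-/suc a b) (toℚᵘ-/suc c d))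
    (ℚᵘₚ.≃-trans (ℚᵘₚ.≃-reflexive (cong (λ z → mkℚᵘ z (d + b * suc d)) (sym (ℤₚ.pos-* a c))))
      (ℚᵘₚ.≃-sym (toℚᵘ-/suc (a * c) (d + b * suc d))))))

fromℕ : ℕ → ℚ
fromℕ a = + a / 1

fromℕ-+ : ∀ a b → fromℕ (a + b) ≡ fromℕ a ℚ.+ fromℕ b
fromℕ-+ a b = trans (/suc-≡ (a + b) 0 (a * 1 + b * 1) 0 (cross a b)) (sym (/suc-+ a 0 b 0))
  where
  cross : ∀ a b → (a + b) * 1 ≡ (a * 1 + b * 1) * 1
  cross = solve-∀

fromℕ*1/suc : ∀ a m → fromℕ a ℚ.* (+ 1 / suc m) ≡ + a / suc m
fromℕ*1/suc a m = trans (/suc-* a 0 1 m) (/suc-≡ (a * 1) (m + 0) a m (cross a m))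
  where
  cross : ∀ a m → a * 1 * suc m ≡ a * suc (m + 0)
  cross = solve-∀

fromℕ-suc*1/suc : ∀ m → fromℕ (suc m) ℚ.* (+ 1 / suc m) ≡ 1ℚ
fromℕ-suc*1/suc m = trans (fromℕ*1/suc (suc m) m) (/suc-≡ (suc m) m 1 0 (cross m))
  where
  cross : ∀ m → suc m * 1 ≡ 1 * suc m
  cross = solve-∀

sumℚ-fromℕ : ∀ {A : Set} (f : A → ℕ) (xs : List A) → sumℚ (map (fromℕ ∘ f) xs) ≡ fromℕ (sum (map f xs))
sumℚ-fromℕ f [] = refl
sumℚ-fromℕ f (x ∷ xs) =
  trans (cong (fromℕ (f x) ℚ.+_) (sumℚ-fromℕ f xs)) (sym (fromℕ-+ (f x) (sum (map f xs))))

-- Consecutive means s/(s+1), s + 2 ≤ n, are 1/((s+1)(s+2)) ≥ 1/n² apart: more than two tolerances.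
tolerance : ℕ → ℚ
tolerance n = + 1 / suc (2 * (n * n))

tolerance-pos : ∀ n → 0ℚ ℚ.< tolerance n
tolerance-pos n = ℚₚ.positive⁻¹ (tolerance n) {{ℚₚ.normalize-pos 1 (suc (2 * (n * n)))}}

consecutive-means : ∀ s → + s / suc s ℚ.+ + 1 / (suc s * suc (suc s)) ≡ + suc s / suc (suc s)
consecutive-means s =
  trans (/suc-+ s s 1 D) (/suc-≡ (s * suc D + 1 * suc s) (D + s * suc D) (suc s) (suc s) (cross s))
  where
  D = suc s + s * suc (suc s)
  cross : ∀ s → (s * (suc s * suc (suc s)) + 1 * suc s) * suc (suc s)
              ≡ suc s * (suc s * (suc s * suc (suc s)))
  cross = solve-∀

tolerance+tolerance≤ : ∀ {s n} → 2 + s ≤ n → tolerance n ℚ.+ tolerance n ℚ.≤ + 1 / (suc s * suc (suc s))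
tolerance+tolerance≤ {s} {n} 2+s≤n = subst (ℚ._≤ + 1 / (suc s * suc (suc s))) (sym (/suc-+ 1 K 1 K))
  (/suc-≤ (1 * suc K + 1 * suc K) (K + K * suc K) 1 (suc s + s * suc (suc s)) (begin
  (1 * suc K + 1 * suc K) * (suc s * suc (suc s))  ≡⟨ regroup (suc K) (suc s * suc (suc s)) ⟩
  suc K * (2 * (suc s * suc (suc s)))               ≤⟨ ℕₚ.*-monoʳ-≤ (suc K) bound ⟩
  suc K * suc K                                     ≡⟨ ℕₚ.*-identityˡ (suc K * suc K) ⟨
  1 * (suc K * suc K)                               ∎))
  where
  open ℕₚ.≤-Reasoning
  K = 2 * (n * n)
  regroup : ∀ k m → (1 * k + 1 * k) * m ≡ k * (2 * m)
  regroup = solve-∀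
  bound : 2 * (suc s * suc (suc s)) ≤ suc K
  bound = ℕₚ.m≤n⇒m≤1+n (ℕₚ.*-monoʳ-≤ 2 (ℕₚ.*-mono-≤ (ℕₚ.≤-trans (ℕₚ.n≤1+n (suc s)) 2+s≤n) 2+s≤n))

means-separated : ∀ {s n} → 2 + s ≤ n →
  + s / suc s ℚ.+ tolerance n ℚ.+ tolerance n ℚ.≤ + suc s / suc (suc s)
means-separated {s} {n} 2+s≤n = begin
  + s / suc s ℚ.+ tolerance n ℚ.+ tolerance n
    ≡⟨ ℚₚ.+-assoc (+ s / suc s) (tolerance n) (tolerance n) ⟩
  + s / suc s ℚ.+ (tolerance n ℚ.+ tolerance n)
    ≤⟨ ℚₚ.+-monoʳ-≤ (+ s / suc s) (tolerance+tolerance≤ 2+s≤n) ⟩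
  + s / suc s ℚ.+ + 1 / (suc s * suc (suc s))
    ≡⟨ consecutive-means s ⟩
  + suc s / suc (suc s) ∎
  where open ℚₚ.≤-Reasoning

p≤∣p∣ : ∀ p → p ℚ.≤ ∣ p ∣
p≤∣p∣ (ℚ.mkℚ (+ _) _ _) = ℚₚ.≤-refl
p≤∣p∣ p@(ℚ.mkℚ ℤ.-[1+ _ ] _ _) = ℚₚ.≤-trans (ℚₚ.<⇒≤ (ℚₚ.negative⁻¹ p)) (ℚₚ.0≤∣p∣ p)

∣p-q∣<ε⇒p≤q+ε : ∀ p q {ε} → ∣ p ℚ.- q ∣ ℚ.< ε → p ℚ.≤ q ℚ.+ ε
∣p-q∣<ε⇒p≤q+ε p q {ε} ∣p-q∣<ε = begin
  p                 ≡⟨ solve 2 (λ p q → p := (p :- q) :+ q) refl p q ⟩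
  (p ℚ.- q) ℚ.+ q   ≤⟨ ℚₚ.+-monoˡ-≤ q (ℚₚ.<⇒≤ (ℚₚ.≤-<-trans (p≤∣p∣ (p ℚ.- q)) ∣p-q∣<ε)) ⟩
  ε ℚ.+ q           ≡⟨ ℚₚ.+-comm ε q ⟩
  q ℚ.+ ε           ∎
  where
  open ℚₚ.≤-Reasoning
  open +-*-Solver

∣p-q∣≡∣q-p∣ : ∀ p q → ∣ p ℚ.- q ∣ ≡ ∣ q ℚ.- p ∣
∣p-q∣≡∣q-p∣ p q = trans (cong ∣_∣ (solve 2 (λ p q → p :- q := :- (q :- p)) refl p q)) (ℚₚ.∣-p∣≡∣p∣ (q ℚ.- p))
  where open +-*-Solver

sumℚ-≤-+ : ∀ {A : Set} (x z : A → ℚ) ε → (∀ a → x a ℚ.≤ z a ℚ.+ ε) → ∀ xs →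
  sumℚ (map x xs) ℚ.≤ sumℚ (map z xs) ℚ.+ fromℕ (length xs) ℚ.* ε
sumℚ-≤-+ x z ε x≤z+ε [] = ℚₚ.≤-reflexive (solve 1 (λ e → con 0ℚ := con 0ℚ :+ con 0ℚ :* e) refl ε)
  where open +-*-Solver
sumℚ-≤-+ x z ε x≤z+ε (a ∷ xs) = begin
  x a ℚ.+ sumℚ (map x xs)
    ≤⟨ ℚₚ.+-mono-≤ (x≤z+ε a) (sumℚ-≤-+ x z ε x≤z+ε xs) ⟩
  (z a ℚ.+ ε) ℚ.+ (sumℚ (map z xs) ℚ.+ fromℕ (length xs) ℚ.* ε)
    ≡⟨ solve 4 (λ za e sz l → (za :+ e) :+ (sz :+ l :* e) := (za :+ sz) :+ (con 1ℚ :+ l) :* e)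
             refl (z a) ε (sumℚ (map z xs)) (fromℕ (length xs)) ⟩
  (z a ℚ.+ sumℚ (map z xs)) ℚ.+ (1ℚ ℚ.+ fromℕ (length xs)) ℚ.* ε
    ≡⟨ cong (λ c → (z a ℚ.+ sumℚ (map z xs)) ℚ.+ c ℚ.* ε) (fromℕ-+ 1 (length xs)) ⟨
  (z a ℚ.+ sumℚ (map z xs)) ℚ.+ fromℕ (suc (length xs)) ℚ.* ε ∎
  where
  open ℚₚ.≤-Reasoning
  open +-*-Solver

avgD-≡ : ∀ {n} (F : MaximalChain n) k (x : Point n) {m} → length (Dlist F k) ≡ suc m →
  avgD F k x ≡ sumℚ (map x (Dlist F k)) ℚ.* (+ 1 / suc m)
avgD-≡ F k x eq with length (Dlist F k) | eq
... | _ | refl = refl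

avgD-≤-+ : ∀ {n} (F : MaximalChain n) k (x z : Point n) {ε} → 0ℚ ℚ.≤ ε → (∀ q → x q ℚ.≤ z q ℚ.+ ε) →
  avgD F k x ℚ.≤ avgD F k z ℚ.+ ε
avgD-≤-+ F k x z {ε} 0≤ε x≤z+ε with length (Dlist F k) in eq
... | zero  = ℚₚ.≤-trans 0≤ε (ℚₚ.≤-reflexive (sym (ℚₚ.+-identityˡ ε)))
... | suc m = begin
  Σx ℚ.* r
    ≤⟨ ℚₚ.*-monoʳ-≤-nonNeg r {{ℚₚ.normalize-nonNeg 1 (suc m)}} (sumℚ-≤-+ x z ε x≤z+ε (Dlist F k)) ⟩
  (Σz ℚ.+ fromℕ (length (Dlist F k)) ℚ.* ε) ℚ.* r
    ≡⟨ cong (λ l → (Σz ℚ.+ fromℕ l ℚ.* ε) ℚ.* r) eq ⟩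
  (Σz ℚ.+ fromℕ (suc m) ℚ.* ε) ℚ.* r
    ≡⟨ solve 4 (λ s l e r → (s :+ l :* e) :* r := s :* r :+ (l :* r) :* e) refl Σz (fromℕ (suc m)) ε r ⟩
  Σz ℚ.* r ℚ.+ (fromℕ (suc m) ℚ.* r) ℚ.* ε
    ≡⟨ cong (λ c → Σz ℚ.* r ℚ.+ c ℚ.* ε) (fromℕ-suc*1/suc m) ⟩
  Σz ℚ.* r ℚ.+ 1ℚ ℚ.* ε
    ≡⟨ cong (Σz ℚ.* r ℚ.+_) (ℚₚ.*-identityˡ ε) ⟩
  Σz ℚ.* r ℚ.+ ε ∎
  where
  open ℚₚ.≤-Reasoning
  open +-*-Solver
  r = + 1 / suc m
  Σx = sumℚ (map x (Dlist F k))
  Σz = sumℚ (map z (Dlist F k))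

avgD-near : ∀ {n} (F : MaximalChain n) k (y d : Point n) {ε} → 0ℚ ℚ.< ε → (∀ q → ∣ y q ℚ.- d q ∣ ℚ.< ε) →
  avgD F k y ℚ.≤ avgD F k d ℚ.+ ε × avgD F k d ℚ.≤ avgD F k y ℚ.+ ε
avgD-near F k y d {ε} 0<ε close =
  avgD-≤-+ F k y d 0≤ε (λ q → ∣p-q∣<ε⇒p≤q+ε (y q) (d q) (close q)) ,
  avgD-≤-+ F k d y 0≤ε (λ q → ∣p-q∣<ε⇒p≤q+ε (d q) (y q) (subst (ℚ._< ε) (∣p-q∣≡∣q-p∣ (y q) (d q)) (close q)))
  where
  0≤ε : 0ℚ ℚ.≤ ε
  0≤ε = ℚₚ.<⇒≤ 0<ε

≤-across-gap : ∀ {a b c d ε} → a ℚ.≤ b ℚ.+ ε → b ℚ.+ ε ℚ.+ ε ℚ.≤ c → c ℚ.≤ d ℚ.+ ε → a ℚ.≤ d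
≤-across-gap {a} {b} {c} {d} {ε} a≤b+ε gap c≤d+ε = begin
  a                       ≡⟨ solve 2 (λ a e → a := (a :+ e) :- e) refl a ε ⟩
  (a ℚ.+ ε) ℚ.- ε         ≤⟨ ℚₚ.+-monoˡ-≤ (ℚ.- ε) a+ε≤d+ε ⟩
  (d ℚ.+ ε) ℚ.- ε         ≡⟨ solve 2 (λ d e → (d :+ e) :- e := d) refl d ε ⟩
  d                       ∎
  where
  open ℚₚ.≤-Reasoning
  open +-*-Solver
  a+ε≤d+ε : a ℚ.+ ε ℚ.≤ d ℚ.+ ε
  a+ε≤d+ε = ℚₚ.≤-trans (ℚₚ.+-monoˡ-≤ ε a≤b+ε) (ℚₚ.≤-trans gap c≤d+ε)

weight : ∀ {n} → Fin n → ℕ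
weight zero    = 0
weight (suc _) = 1

dataPoint : ∀ {n} → Point n
dataPoint = uncurryPair (λ i j → fromℕ (weight i * weight j))

-- π_k has a single non-singleton block, the elements of rank ≤ k (S_k); step k + 1 merges it
-- with the element of rank k + 1 (T_k = { added }).
module Caterpillar {p : ℕ} (ρ : Permutation′ (suc p)) where

  rank : Fin (suc p) → ℕ
  rank x = toℕ (ρ ⟨$⟩ʳ x)

  joined : ℕ → Fin (suc p) → Bool
  joined k x = does (rank x ℕ.≤? k)

  partitions : PartSeq (suc p)
  partitions k x y = does (x ≟ y) ∨ (joined k x ∧ joined k y)

  root : Fin (suc p)
  root = ρ ⟨$⟩ˡ zero

  added : ∀ {k} → k < p → Fin (suc p)
  added k<p = ρ ⟨$⟩ˡ suc (Fin.fromℕ< k<p)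

  rank-root : rank root ≡ 0
  rank-root = cong toℕ (inverseʳ ρ)

  rank⇒≡⟨$⟩ˡ : ∀ {z} i → rank z ≡ toℕ i → z ≡ ρ ⟨$⟩ˡ i
  rank⇒≡⟨$⟩ˡ {z} i eq = trans (sym (inverseˡ ρ)) (cong (ρ ⟨$⟩ˡ_) (Finₚ.toℕ-injective eq))

  rank-added : ∀ {k} (k<p : k < p) → rank (added k<p) ≡ suc k
  rank-added k<p = trans (cong toℕ (inverseʳ ρ)) (cong suc (Finₚ.toℕ-fromℕ< k<p))

  joined-root : ∀ k → joined k root ≡ true
  joined-root k = dec-true (rank root ℕ.≤? k) (ℕₚ.≤-trans (ℕₚ.≤-reflexive rank-root) z≤n)

  joined-added : ∀ {k} (k<p : k < p) → joined k (added k<p) ≡ false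
  joined-added {k} k<p = dec-false (rank (added k<p) ℕ.≤? k)
    (λ le → ℕₚ.1+n≰n (ℕₚ.≤-trans (ℕₚ.≤-reflexive (sym (rank-added k<p))) le))

  joined-zero : ∀ z → joined 0 z ≡ does (z ≟ root)
  joined-zero z = does-⇔ (mk⇔ (λ le → rank⇒≡⟨$⟩ˡ zero (ℕₚ.n≤0⇒n≡0 le))
                              (λ { refl → ℕₚ.≤-reflexive rank-root }))
                         (rank z ℕ.≤? 0) (z ≟ root)

  joined-suc : ∀ {k} (k<p : k < p) z → joined (suc k) z ≡ joined k z ∨ does (z ≟ added k<p)
  joined-suc {k} k<p z = does-⇔ (mk⇔ to from) (rank z ℕ.≤? suc k) ((rank z ℕ.≤? k) ⊎-dec (z ≟ added k<p))
    where
    to : rank z ≤ suc k → rank z ≤ k ⊎ z ≡ added k<p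
    to le = Sum.map ℕ.s≤s⁻¹ (λ eq → rank⇒≡⟨$⟩ˡ _ (trans eq (cong suc (sym (Finₚ.toℕ-fromℕ< k<p)))))
                         (ℕₚ.m≤n⇒m<n∨m≡n le)
    from : rank z ≤ k ⊎ z ≡ added k<p → rank z ≤ suc k
    from = [ ℕₚ.m≤n⇒m≤1+n , (λ { refl → ℕₚ.≤-reflexive (rank-added k<p) }) ]′

  joined-rank : ∀ x → joined (rank x) x ≡ true
  joined-rank x = dec-true (rank x ℕ.≤? rank x) ℕₚ.≤-refl

  joined-before-rank : ∀ {k} x → k < rank x → joined k x ≡ false
  joined-before-rank {k} x k<rank = dec-false (rank x ℕ.≤? k) (ℕₚ.<⇒≱ k<rank)

  root≢added : ∀ {k} (k<p : k < p) → root ≢ added k<p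
  root≢added k<p eq = ℕₚ.0≢1+n (trans (sym rank-root) (trans (cong rank eq) (rank-added k<p)))

  partitions-root : ∀ k x → partitions k x root ≡ joined k x
  partitions-root k x with x ≟ root
  ... | yes refl = sym (joined-root k)
  ... | no _ rewrite joined-root k = Boolₚ.∧-identityʳ (joined k x)

  partitions-added : ∀ {k} (k<p : k < p) y → partitions k y (added k<p) ≡ does (y ≟ added k<p)
  partitions-added {k} k<p y rewrite joined-added k<p | Boolₚ.∧-zeroʳ (joined k y) =
    Boolₚ.∨-identityʳ (does (y ≟ added k<p))

  partitions-suc : ∀ {k} (k<p : k < p) x y →
    partitions (suc k) x y ≡ partitions k x y ∨ ((partitions k x root ∧ partitions k y (added k<p))
                                                 ∨ (partitions k x (added k<p) ∧ partitions k y root))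
  partitions-suc {k} k<p x y with x ≟ y
  ... | yes refl = refl
  ... | no x≢y = begin
    joined (suc k) x ∧ joined (suc k) y
      ≡⟨ cong₂ _∧_ (joined-suc k<p x) (joined-suc k<p y) ⟩
    (joined k x ∨ does (x ≟ b)) ∧ (joined k y ∨ does (y ≟ b))
      ≡⟨ ∧-∨-expand (joined k x) (joined k y) (does (x ≟ b)) (does (y ≟ b)) (distinct-∧ b x≢y) ⟩
    (joined k x ∧ joined k y) ∨ ((joined k x ∧ does (y ≟ b)) ∨ (does (x ≟ b) ∧ joined k y))
      ≡⟨ cong (λ q → (joined k x ∧ joined k y) ∨ q)
              (cong₂ _∨_ (cong₂ _∧_ (partitions-root k x) (partitions-added k<p y))
                         (cong₂ _∧_ (partitions-added k<p x) (partitions-root k y))) ⟨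
    (joined k x ∧ joined k y)
      ∨ ((partitions k x root ∧ partitions k y b) ∨ (partitions k x b ∧ partitions k y root)) ∎
    where
    open ≡-Reasoning
    b = added k<p

  partitions-zero : ∀ x y → partitions 0 x y ≡ does (x ≟ y)
  partitions-zero x y with x ≟ y
  ... | yes _ = refl
  ... | no x≢y rewrite joined-zero x | joined-zero y = distinct-∧ root x≢y

  caterpillar : MaximalChain (suc p)
  caterpillar = partitions , partitions-zero , λ { k (s≤s k<p) →
    root , added k<p , trans (partitions-added k<p root) (dec-false (root ≟ added k<p) (root≢added k<p)) ,
    partitions-suc k<p }

  not-added-and-joined : ∀ {k} (k<p : k < p) z → does (z ≟ added k<p) ∧ joined k z ≡ false
  not-added-and-joined k<p z with z ≟ added k<p
  ... | yes refl = joined-added k<p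
  ... | no _     = refl

  partitions-≢ : ∀ k {x y} → x ≢ y → partitions k x y ≡ joined k x ∧ joined k y
  partitions-≢ k {x} {y} x≢y rewrite dec-false (x ≟ y) x≢y = refl

  new-pair : ∀ {k} (k<p : k < p) (g : Fin (suc p) → Fin (suc p) → ℕ) → (∀ i j → g i j ≡ g j i) →
    ∀ {i j} → i ≢ j → let b = added k<p in
    𝟙 (partitions (suc k) i j ∧ not (partitions k i j)) * g i j
      ≡ δ i b * (𝟙 (joined k j) * g b j) + δ j b * (𝟙 (joined k i) * g b i)
  new-pair {k} k<p g g-sym {i} {j} i≢j = begin
    𝟙 (partitions (suc k) i j ∧ not (partitions k i j)) * g i j
      ≡⟨ cong (λ q → 𝟙 q * g i j) (cong₂ (λ u v → u ∧ not v)
           (trans (partitions-≢ (suc k) i≢j) (cong₂ _∧_ (joined-suc k<p i) (joined-suc k<p j)))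
           (partitions-≢ k i≢j)) ⟩
    𝟙 (((Ji ∨ δᵇ i) ∧ (Jj ∨ δᵇ j)) ∧ not (Ji ∧ Jj)) * g i j
      ≡⟨ cong (_* g i j) (𝟙-new-pair Ji Jj (δᵇ i) (δᵇ j) (not-added-and-joined k<p i)
                                      (not-added-and-joined k<p j) (distinct-∧ b i≢j)) ⟩
    (δ i b * 𝟙 Jj + δ j b * 𝟙 Ji) * g i j
      ≡⟨ distrib (δ i b) (𝟙 Jj) (δ j b) (𝟙 Ji) (g i j) ⟩
    δ i b * (𝟙 Jj * g i j) + δ j b * (𝟙 Ji * g i j)
      ≡⟨ cong₂ _+_ (δ-subst i b (λ x → 𝟙 Jj * g x j))
                   (trans (δ-subst j b (λ x → 𝟙 Ji * g i x)) (cong (λ v → δ j b * (𝟙 Ji * v)) (g-sym i b))) ⟩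
    δ i b * (𝟙 Jj * g b j) + δ j b * (𝟙 Ji * g b i) ∎
    where
    open ≡-Reasoning
    b = added k<p
    Ji = joined k i
    Jj = joined k j
    δᵇ : Fin (suc p) → Bool
    δᵇ x = does (x ≟ b)
    distrib : ∀ a c d e f → (a * c + d * e) * f ≡ a * (c * f) + d * (e * f)
    distrib = solve-∀

  sum-new-pairs : ∀ {k} (k<p : k < p) (g : Fin (suc p) → Fin (suc p) → ℕ) → (∀ i j → g i j ≡ g j i) →
    sum (map (uncurryPair g) (Dlist caterpillar (suc k))) ≡ ∑[ x < suc p ] (𝟙 (joined k x) * g (added k<p) x)
  sum-new-pairs {k} k<p g g-sym = begin
    sum (map (uncurryPair g) (Dlist caterpillar (suc k)))
      ≡⟨ sum-filter (inD caterpillar (suc k)) (uncurryPair g) (allPairs (suc p)) ⟩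
    sum (map (uncurryPair G) (allPairs (suc p)))
      ≡⟨ sum-allPairs G ⟩
    ∑[ i < suc p ] ∑[ j < suc p ] (𝟙< i j * G i j)
      ≡⟨ sum-cong-≗ (λ i → sum-cong-≗ (ordered i)) ⟩
    ∑[ i < suc p ] ∑[ j < suc p ] (𝟙< i j * (δ i b * h j + δ j b * h i))
      ≡⟨ ∑-pairs-through b h (cong (λ q → 𝟙 q * g b b) (joined-added k<p)) ⟩
    ∑[ x < suc p ] h x ∎
    where
    open ≡-Reasoning
    b = added k<p
    G : Fin (suc p) → Fin (suc p) → ℕ
    G i j = 𝟙 (partitions (suc k) i j ∧ not (partitions k i j)) * g i j
    h : Fin (suc p) → ℕ
    h x = 𝟙 (joined k x) * g b x
    ordered : ∀ i j → 𝟙< i j * G i j ≡ 𝟙< i j * (δ i b * h j + δ j b * h i)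
    ordered i j with i <? j
    ... | yes i<j rewrite dec-true (i <? j) i<j = cong (1 *_) (new-pair k<p g g-sym (Finₚ.<⇒≢ i<j))
    ... | no i≮j  rewrite dec-false (i <? j) i≮j = refl

  root≡zero : ρ ⟨$⟩ʳ zero ≡ zero → root ≡ zero
  root≡zero fix = trans (cong (ρ ⟨$⟩ˡ_) (sym fix)) (inverseˡ ρ)

  partitions-zeroth : ρ ⟨$⟩ʳ zero ≡ zero → ∀ k x → partitions k x zero ≡ joined k x
  partitions-zeroth fix k x = subst (λ r → partitions k x r ≡ joined k x) (root≡zero fix) (partitions-root k x)

  joined-zeroth : ρ ⟨$⟩ʳ zero ≡ zero → ∀ k → joined k zero ≡ true
  joined-zeroth fix k = subst (λ r → joined k r ≡ true) (root≡zero fix) (joined-root k)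

  weight-added : ρ ⟨$⟩ʳ zero ≡ zero → ∀ {k} (k<p : k < p) → weight (added k<p) ≡ 1
  weight-added fix k<p with added k<p | root≢added k<p
  ... | zero  | root≢zero = ⊥-elim (root≢zero (root≡zero fix))
  ... | suc _ | _         = refl

  count-joined : ∀ {k} → k < suc p → ∑[ x < suc p ] 𝟙 (joined k x) ≡ suc k
  count-joined {k} k<n = trans (sym (∑-permute (λ y → 𝟙 (does (toℕ y ℕ.≤? k))) ρ)) (count-≤ k<n)

  count-joined-weighted : ρ ⟨$⟩ʳ zero ≡ zero → ∀ {k} → k < suc p →
    ∑[ x < suc p ] (𝟙 (joined k x) * weight x) ≡ k
  count-joined-weighted fix {k} k<n = ℕₚ.suc-injective (begin
    suc (∑[ x < suc p ] (𝟙 (joined k x) * weight x))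
      ≡⟨ cong suc (cong₂ _+_ (ℕₚ.*-zeroʳ (𝟙 (joined k zero)))
                             (sum-cong-≗ {p} (λ x → ℕₚ.*-identityʳ (𝟙 (joined k (suc x)))))) ⟩
    suc (∑[ x < p ] 𝟙 (joined k (suc x)))
      ≡⟨ cong (λ j → 𝟙 j + ∑[ x < p ] 𝟙 (joined k (suc x))) (joined-zeroth fix k) ⟨
    ∑[ x < suc p ] 𝟙 (joined k x)
      ≡⟨ count-joined k<n ⟩
    suc k ∎)
    where open ≡-Reasoning

  size-new-pairs : ∀ {k} (k<p : k < p) → length (Dlist caterpillar (suc k)) ≡ suc k
  size-new-pairs {k} k<p = begin
    length (Dlist caterpillar (suc k))
      ≡⟨ length≡sum-of-ones (Dlist caterpillar (suc k)) ⟩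
    sum (map (uncurryPair (λ _ _ → 1)) (Dlist caterpillar (suc k)))
      ≡⟨ sum-new-pairs k<p (λ _ _ → 1) (λ _ _ → refl) ⟩
    ∑[ x < suc p ] (𝟙 (joined k x) * 1)
      ≡⟨ sum-cong-≗ {suc p} (λ x → ℕₚ.*-identityʳ (𝟙 (joined k x))) ⟩
    ∑[ x < suc p ] 𝟙 (joined k x)
      ≡⟨ count-joined (ℕₚ.m≤n⇒m≤1+n k<p) ⟩
    suc k ∎
    where open ≡-Reasoning

  sum-dataPoint-new-pairs : ρ ⟨$⟩ʳ zero ≡ zero → ∀ {k} (k<p : k < p) →
    sumℚ (map dataPoint (Dlist caterpillar (suc k))) ≡ fromℕ k
  sum-dataPoint-new-pairs fix {k} k<p =
    trans (sumℚ-fromℕ (uncurryPair g) (Dlist caterpillar (suc k))) (cong fromℕ (begin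
    sum (map (uncurryPair g) (Dlist caterpillar (suc k)))
      ≡⟨ sum-new-pairs k<p g (λ i j → ℕₚ.*-comm (weight i) (weight j)) ⟩
    ∑[ x < suc p ] (𝟙 (joined k x) * (weight (added k<p) * weight x))
      ≡⟨ sum-cong-≗ {suc p} (λ x → cong (λ w → 𝟙 (joined k x) * (w * weight x)) (weight-added fix k<p)) ⟩
    ∑[ x < suc p ] (𝟙 (joined k x) * (1 * weight x))
      ≡⟨ sum-cong-≗ {suc p} (λ x → cong (𝟙 (joined k x) *_) (ℕₚ.*-identityˡ (weight x))) ⟩
    ∑[ x < suc p ] (𝟙 (joined k x) * weight x)
      ≡⟨ count-joined-weighted fix (ℕₚ.m≤n⇒m≤1+n k<p) ⟩
    k ∎))
    where
    open ≡-Reasoning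
    g : Fin (suc p) → Fin (suc p) → ℕ
    g i j = weight i * weight j

  mean-dataPoint : ρ ⟨$⟩ʳ zero ≡ zero → ∀ {k} (k<p : k < p) → avgD caterpillar (suc k) dataPoint ≡ + k / suc k
  mean-dataPoint fix {k} k<p = begin
    avgD caterpillar (suc k) dataPoint
      ≡⟨ avgD-≡ caterpillar (suc k) dataPoint (size-new-pairs k<p) ⟩
    sumℚ (map dataPoint (Dlist caterpillar (suc k))) ℚ.* (+ 1 / suc k)
      ≡⟨ cong (ℚ._* (+ 1 / suc k)) (sum-dataPoint-new-pairs fix k<p) ⟩
    fromℕ k ℚ.* (+ 1 / suc k)
      ≡⟨ fromℕ*1/suc k k ⟩
    + k / suc k ∎
    where open ≡-Reasoning

  dataPoint-interior : ρ ⟨$⟩ʳ zero ≡ zero → InInterior (inP caterpillar) dataPoint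
  dataPoint-interior fix = ε , tolerance-pos (suc p) , means-ordered
    where
    ε = tolerance (suc p)
    means-ordered : ∀ y → (∀ q → ∣ y q ℚ.- dataPoint q ∣ ℚ.< ε) → inP caterpillar y
    means-ordered y close k (s≤s 1+k<p) = ≤-across-gap {b = avgD caterpillar (suc k) dataPoint}
      (proj₁ (avgD-near caterpillar (suc k) y dataPoint (tolerance-pos (suc p)) close))
      gap
      (proj₂ (avgD-near caterpillar (suc (suc k)) y dataPoint (tolerance-pos (suc p)) close))
      where
      k<p : k < p
      k<p = ℕₚ.<-trans (ℕₚ.n<1+n k) 1+k<p
      gap : avgD caterpillar (suc k) dataPoint ℚ.+ ε ℚ.+ ε ℚ.≤ avgD caterpillar (suc (suc k)) dataPoint
      gap = subst₂ (λ u v → u ℚ.+ ε ℚ.+ ε ℚ.≤ v) (sym (mean-dataPoint fix k<p)) (sym (mean-dataPoint fix 1+k<p))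
                   (means-separated (ℕₚ.m≤n⇒m≤1+n 1+k<p))
module _ {p} {ρ ρ′ : Permutation′ (suc p)} (fix : ρ ⟨$⟩ʳ zero ≡ zero) (fix′ : ρ′ ⟨$⟩ʳ zero ≡ zero) where
  private
    module C = Caterpillar ρ
    module C′ = Caterpillar ρ′
    true≢false : true ≢ false
    true≢false ()

  joined-apart : ∀ k x → k < suc p → C.joined k x ≢ C′.joined k x →
    DistinctChains C.caterpillar C′.caterpillar
  joined-apart k x k<n ne = k , k<n , x , zero ,
    λ eq → ne (trans (sym (C.partitions-zeroth fix k x)) (trans eq (C′.partitions-zeroth fix′ k x)))

  caterpillars-distinct : ∀ x → ρ ⟨$⟩ʳ x ≢ ρ′ ⟨$⟩ʳ x → DistinctChains C.caterpillar C′.caterpillar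
  caterpillars-distinct x ρx≢ρ′x with ℕₚ.<-cmp (C.rank x) (C′.rank x)
  ... | tri< r<r′ _ _ = joined-apart (C.rank x) x (Finₚ.toℕ<n (ρ ⟨$⟩ʳ x))
    (λ eq → true≢false (trans (sym (C.joined-rank x)) (trans eq (C′.joined-before-rank x r<r′))))
  ... | tri≈ _ r≡r′ _ = ⊥-elim (ρx≢ρ′x (Finₚ.toℕ-injective r≡r′))
  ... | tri> _ _ r′<r = joined-apart (C′.rank x) x (Finₚ.toℕ<n (ρ′ ⟨$⟩ʳ x))
    (λ eq → true≢false (trans (sym (C′.joined-rank x)) (trans (sym eq) (C.joined-before-rank x r′<r))))

theorem3p8 : (n : ℕ) → 2 ≤ n →
    Σ (Point n) λ d →
      Σ (Fin ((n ∸ 1) !) → MaximalChain n) λ chains →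
        (∀ a b → a ≢ b → DistinctChains (chains a) (chains b)) ×
        (∀ a → InInterior (inP (chains a)) d)
theorem3p8 (suc p) _ = dataPoint , chain , distinct , λ a → Caterpillar.dataPoint-interior (ordering a) refl
  where
  ordering : Fin (p !) → Permutation′ (suc p)
  ordering a = lift₀ (permutationAt p a)
  chain : Fin (p !) → MaximalChain (suc p)
  chain a = Caterpillar.caterpillar (ordering a)
  distinct : ∀ a b → a ≢ b → DistinctChains (chain a) (chain b)
  distinct a b a≢b with permutationAt-distinct p a≢b
  ... | x , σx≢σ′x =
    caterpillars-distinct {ρ = ordering a} {ordering b} refl refl (suc x) (σx≢σ′x ∘ Finₚ.suc-injective)
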